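{- Let $f_1(\vec x),\dots,f_m(\vec x),g_1(\vec x),\dots,g_k(\vec x)\in\mathbb{F}[\vec x]$ form a system of equations with no common solution, while $g_1(\vec x)=\dots=g_k(\vec x)=0$ has a solution in $\mathbb{F}^n$. Let $C\in\mathbb{F}[\vec x,\vec y,\vec z]$ (with $\vec y=(y_1,\dots,y_m)$, $\vec z=(z_1,\dots,z_k)$) be an IPS refutation of $f_1,\dots,f_m,g_1,\dots,g_k$. Then $1-C(\vec x,\vec 0,g_1(\vec x),\dots,g_k(\vec x))$ is a nonzero element of the ideal $\langle f_1(\vec x),\dots,f_m(\vec x)\rangle\subseteq\mathbb{F}[\vec x]$.
   Context: An IPS refutation of $f_1,\dots,f_m,g_1,\dots,g_k$ is a polynomial $C(\vec x,\vec y,\vec z)$ such that $C(\vec x,\vec 0,\vec 0)=0$ and $C(\vec x,f_1(\vec x),\dots,f_m(\vec x),g_1(\vec x),\dots,g_k(\vec x))=1$. -}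

module Defs where

open import Level using (Level; _⊔_) renaming (suc to lsuc)
open import Algebra.Bundles using (CommutativeRing)
open import Data.Nat using (ℕ; zero; suc)
open import Data.Fin using (Fin; zero; suc)
open import Data.Sum using (_⊎_; inj₁; inj₂)
open import Data.Product using (Σ; ∃; _×_; _,_)
open import Relation.Nullary using (¬_)

record Field (c ℓ : Level) : Set (lsuc (c ⊔ ℓ)) where
  field
    commutativeRing : CommutativeRing c ℓ
  open CommutativeRing commutativeRing public
  field
    0≉1     : ¬ (0# ≈ 1#)
    inverse : ∀ x → ¬ (x ≈ 0#) → ∃ λ y → (x * y) ≈ 1#

module Poly {c ℓ : Level} (𝔽 : Field c ℓ) where
  open Field 𝔽 using (Carrier; _≈_; _+_; _*_; -_; 0#; 1#)

  data Term (V : Set) : Set c where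
    var  : V → Term V
    con  : Carrier → Term V
    _⊕_  : Term V → Term V → Term V
    _⊗_  : Term V → Term V → Term V
    ⊝_   : Term V → Term V

  infixl 6 _⊕_
  infixl 7 _⊗_
  infix  8 ⊝_
  infix  4 _≋_

  -- Equality in the polynomial ring 𝔽[V]: the least congruence making
  -- Term V a commutative 𝔽-algebra (so Term V / ≋ is exactly 𝔽[V]).
  data _≋_ {V : Set} : Term V → Term V → Set (c ⊔ ℓ) where
    ≋-refl  : ∀ {p} → p ≋ p
    ≋-sym   : ∀ {p q} → p ≋ q → q ≋ p
    ≋-trans : ∀ {p q r} → p ≋ q → q ≋ r → p ≋ r
    ⊕-cong  : ∀ {p p' q q'} → p ≋ p' → q ≋ q' → p ⊕ q ≋ p' ⊕ q'
    ⊗-cong  : ∀ {p p' q q'} → p ≋ p' → q ≋ q' → p ⊗ q ≋ p' ⊗ q'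
    ⊝-cong  : ∀ {p q} → p ≋ q → ⊝ p ≋ ⊝ q
    ⊕-assoc : ∀ p q r → (p ⊕ q) ⊕ r ≋ p ⊕ (q ⊕ r)
    ⊕-comm  : ∀ p q → p ⊕ q ≋ q ⊕ p
    ⊕-idˡ   : ∀ p → con 0# ⊕ p ≋ p
    ⊝-invˡ  : ∀ p → (⊝ p) ⊕ p ≋ con 0#
    ⊗-assoc : ∀ p q r → (p ⊗ q) ⊗ r ≋ p ⊗ (q ⊗ r)
    ⊗-comm  : ∀ p q → p ⊗ q ≋ q ⊗ p
    ⊗-idˡ   : ∀ p → con 1# ⊗ p ≋ p
    ⊗-distribˡ : ∀ p q r → p ⊗ (q ⊕ r) ≋ (p ⊗ q) ⊕ (p ⊗ r)
    con-cong : ∀ {a b} → a ≈ b → con a ≋ con b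
    con-+   : ∀ a b → con (a + b) ≋ con a ⊕ con b
    con-*   : ∀ a b → con (a * b) ≋ con a ⊗ con b
    con--   : ∀ a → con (- a) ≋ ⊝ con a

  subst : {V W : Set} → (V → Term W) → Term V → Term W
  subst σ (var v) = σ v
  subst σ (con a) = con a
  subst σ (p ⊕ q) = subst σ p ⊕ subst σ q
  subst σ (p ⊗ q) = subst σ p ⊗ subst σ q
  subst σ (⊝ p)   = ⊝ subst σ p

  eval : {V : Set} → (V → Carrier) → Term V → Carrier
  eval a (var v) = a v
  eval a (con b) = b
  eval a (p ⊕ q) = eval a p + eval a q
  eval a (p ⊗ q) = eval a p * eval a q
  eval a (⊝ p)   = - eval a p

  Σ[_] : {V : Set} (m : ℕ) → (Fin m → Term V) → Term V
  Σ[ zero ]  h = con 0#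
  Σ[ suc m ] h = h zero ⊕ Σ[ m ] (λ i → h (suc i))

  InIdeal : {V : Set} {m : ℕ} → (Fin m → Term V) → Term V → Set (c ⊔ ℓ)
  InIdeal {V} {m} f p = Σ (Fin m → Term V) λ h → p ≋ Σ[ m ] (λ i → h i ⊗ f i)

  -- Variables of C: x (Fin n), y (Fin m), z (Fin k).
  XYZ : ℕ → ℕ → ℕ → Set
  XYZ n m k = Fin n ⊎ (Fin m ⊎ Fin k)

  plug : {n m k : ℕ} → (Fin m → Term (Fin n)) → (Fin k → Term (Fin n))
       → XYZ n m k → Term (Fin n)
  plug F G (inj₁ i)        = var i
  plug F G (inj₂ (inj₁ j)) = F j
  plug F G (inj₂ (inj₂ l)) = G l

  IsIPSRefutation : {n m k : ℕ} → (Fin m → Term (Fin n)) → (Fin k → Term (Fin n))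
                  → Term (XYZ n m k) → Set (c ⊔ ℓ)
  IsIPSRefutation {n} {m} {k} f g C =
    (subst (plug (λ _ → con 0#) (λ _ → con 0#)) C ≋ con 0#)
    × (subst (plug f g) C ≋ con 1#)

  CommonZero : {n k : ℕ} → (Fin k → Term (Fin n)) → (Fin n → Carrier) → Set ℓ
  CommonZero g a = ∀ j → eval a (g j) ≈ 0#

  oneMinusC0g : {n m k : ℕ} → (Fin k → Term (Fin n)) → Term (XYZ n m k) → Term (Fin n)
  oneMinusC0g g C = con 1# ⊕ ⊝ subst (plug (λ _ → con 0#) g) C

  zeroPoly : {V : Set} → Term V
  zeroPoly = con 0#

-- Substituting y ↦ f, z ↦ g and y ↦ 0, z ↦ g into a polynomial gives results that
-- differ by an element of ⟨f⟩, since the two substitutions differ only by the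
-- generators fⱼ. Hence 1 = C(x,f,g) ≡ C(x,0,g) modulo ⟨f⟩. At a common zero a of g,
-- C(a,0,g(a)) = C(a,0,0) = 0, so 1 − C(x,0,g) takes the value 1 at a and is nonzero.
module Submission where

open import Defs
open import Level using (Level; _⊔_)
open import Data.Nat using (ℕ; zero; suc)
open import Data.Fin using (Fin; zero; suc)
open import Data.Product using (∃; _×_; _,_)
open import Data.Sum using (inj₁; inj₂)
open import Relation.Nullary using (¬_)
open import Relation.Binary.Bundles using (Setoid)
open import Relation.Binary.Structures using (IsEquivalence)
open import Algebra.Bundles using (Ring; CommutativeRing)
open import Algebra.Structures using (IsCommutativeRing)
open import Algebra.Consequences.Setoid using (comm∧idˡ⇒idʳ; comm∧invˡ⇒invʳ; comm∧distrˡ⇒distrʳ)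
import Algebra.Properties.Ring as RingProperties
import Algebra.Properties.CommutativeSemigroup as CommutativeSemigroupProperties
import Relation.Binary.Reasoning.Setoid as SetoidReasoning

module _ {r ℓ : Level} (R : Ring r ℓ) where
  open Ring R
  open RingProperties R
  open CommutativeSemigroupProperties +-commutativeSemigroup using (interchange)
  open SetoidReasoning setoid

  +-sub-+ : ∀ x y u v → (x + y) - (u + v) ≈ (x - u) + (y - v)
  +-sub-+ x y u v = begin
    (x + y) + - (u + v)   ≈⟨ +-congˡ (-‿+-comm u v) ⟨
    (x + y) + (- u + - v) ≈⟨ interchange x y (- u) (- v) ⟩
    (x - u) + (y - v)     ∎

  *-sub-* : ∀ x y u v → x * y - u * v ≈ x * (y - v) + (x - u) * v
  *-sub-* x y u v = begin
    x * y - u * v                           ≈⟨ +-congʳ (+-identityʳ (x * y)) ⟨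
    (x * y + 0#) - u * v                    ≈⟨ +-congʳ (+-congˡ (-‿inverseˡ (x * v))) ⟨
    (x * y + (- (x * v) + x * v)) - u * v   ≈⟨ +-congʳ (+-assoc (x * y) _ _) ⟨
    ((x * y - x * v) + x * v) - u * v       ≈⟨ +-assoc (x * y - x * v) _ _ ⟩
    (x * y - x * v) + (x * v - u * v)       ≈⟨ +-cong (x[y-z]≈xy-xz x y v) ([y-z]x≈yx-zx v x u) ⟨
    x * (y - v) + (x - u) * v               ∎

module _ {c ℓ : Level} (𝔽 : Field c ℓ) where
  open Field 𝔽 using (Carrier; _≈_; 0#; 1#; 0≉1)
  module 𝔽 = Field 𝔽
  open Poly 𝔽

  ≋-isEquivalence : {V : Set} → IsEquivalence (_≋_ {V})
  ≋-isEquivalence = record { refl = ≋-refl ; sym = ≋-sym ; trans = ≋-trans }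

  ≋-setoid : Set → Setoid c (c ⊔ ℓ)
  ≋-setoid V = record { isEquivalence = ≋-isEquivalence {V} }

  polynomialRing : Set → CommutativeRing c (c ⊔ ℓ)
  polynomialRing V = record { isCommutativeRing = isCommutativeRing }
    where
    isCommutativeRing : IsCommutativeRing (_≋_ {V}) _⊕_ _⊗_ ⊝_ (con 0#) (con 1#)
    isCommutativeRing = record
      { isRing = record
        { +-isAbelianGroup = record
          { isGroup = record
            { isMonoid = record
              { isSemigroup = record
                { isMagma = record { isEquivalence = ≋-isEquivalence ; ∙-cong = ⊕-cong }
                ; assoc = ⊕-assoc }
              ; identity = ⊕-idˡ , comm∧idˡ⇒idʳ (≋-setoid V) ⊕-comm ⊕-idˡ }
            ; inverse = ⊝-invˡ , comm∧invˡ⇒invʳ (≋-setoid V) ⊕-comm ⊝-invˡ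
            ; ⁻¹-cong = ⊝-cong }
          ; comm = ⊕-comm }
        ; *-cong = ⊗-cong
        ; *-assoc = ⊗-assoc
        ; *-identity = ⊗-idˡ , comm∧idˡ⇒idʳ (≋-setoid V) ⊗-comm ⊗-idˡ
        ; distrib = ⊗-distribˡ , comm∧distrˡ⇒distrʳ (≋-setoid V) ⊕-cong ⊗-comm ⊗-distribˡ }
      ; *-comm = ⊗-comm }

  eval-cong : ∀ {V} (a : V → Carrier) {p q : Term V} → p ≋ q → eval a p ≈ eval a q
  eval-cong a ≋-refl                = 𝔽.refl
  eval-cong a (≋-sym e)             = 𝔽.sym (eval-cong a e)
  eval-cong a (≋-trans e e′)        = 𝔽.trans (eval-cong a e) (eval-cong a e′)
  eval-cong a (⊕-cong e e′)         = 𝔽.+-cong (eval-cong a e) (eval-cong a e′)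
  eval-cong a (⊗-cong e e′)         = 𝔽.*-cong (eval-cong a e) (eval-cong a e′)
  eval-cong a (⊝-cong e)            = 𝔽.-‿cong (eval-cong a e)
  eval-cong a (⊕-assoc p q r)       = 𝔽.+-assoc _ _ _
  eval-cong a (⊕-comm p q)          = 𝔽.+-comm _ _
  eval-cong a (⊕-idˡ p)             = 𝔽.+-identityˡ _
  eval-cong a (⊝-invˡ p)            = 𝔽.-‿inverseˡ _
  eval-cong a (⊗-assoc p q r)       = 𝔽.*-assoc _ _ _
  eval-cong a (⊗-comm p q)          = 𝔽.*-comm _ _
  eval-cong a (⊗-idˡ p)             = 𝔽.*-identityˡ _
  eval-cong a (⊗-distribˡ p q r)    = 𝔽.distribˡ _ _ _
  eval-cong a (con-cong e)          = e
  eval-cong a (con-+ _ _)           = 𝔽.refl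
  eval-cong a (con-* _ _)           = 𝔽.refl
  eval-cong a (con-- _)             = 𝔽.refl

  eval-subst-cong : ∀ {V W} (a : W → Carrier) {σ τ : V → Term W}
                  → (∀ v → eval a (σ v) ≈ eval a (τ v))
                  → ∀ p → eval a (subst σ p) ≈ eval a (subst τ p)
  eval-subst-cong a σ≈τ (var v) = σ≈τ v
  eval-subst-cong a σ≈τ (con b) = 𝔽.refl
  eval-subst-cong a σ≈τ (p ⊕ q) = 𝔽.+-cong (eval-subst-cong a σ≈τ p) (eval-subst-cong a σ≈τ q)
  eval-subst-cong a σ≈τ (p ⊗ q) = 𝔽.*-cong (eval-subst-cong a σ≈τ p) (eval-subst-cong a σ≈τ q)
  eval-subst-cong a σ≈τ (⊝ p)   = 𝔽.-‿cong (eval-subst-cong a σ≈τ p)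

  module _ {V : Set} where
    open CommutativeRing (polynomialRing V)
      using (_-_; ring; +-commutativeSemigroup; +-identityʳ; zeroˡ; zeroʳ; distribˡ; distribʳ)
    open RingProperties ring using (-1*x≈-x; x≈y⇒x∙y⁻¹≈ε; -‿+-comm)
    open CommutativeSemigroupProperties +-commutativeSemigroup using (interchange)
    open SetoidReasoning (≋-setoid V)

    Σ-cong : ∀ m {h h′ : Fin m → Term V} → (∀ i → h i ≋ h′ i) → Σ[ m ] h ≋ Σ[ m ] h′
    Σ-cong zero    h≋h′ = ≋-refl
    Σ-cong (suc m) h≋h′ = ⊕-cong (h≋h′ zero) (Σ-cong m (λ i → h≋h′ (suc i)))

    Σ-zero : ∀ m → Σ[ m ] (λ _ → con 0#) ≋ con {V} 0#
    Σ-zero zero    = ≋-refl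
    Σ-zero (suc m) = ≋-trans (⊕-cong ≋-refl (Σ-zero m)) (⊕-idˡ (con 0#))

    Σ-+ : ∀ m (h h′ : Fin m → Term V) → Σ[ m ] h ⊕ Σ[ m ] h′ ≋ Σ[ m ] (λ i → h i ⊕ h′ i)
    Σ-+ zero    h h′ = ⊕-idˡ (con 0#)
    Σ-+ (suc m) h h′ = ≋-trans (interchange (h zero) _ (h′ zero) _)
                               (⊕-cong ≋-refl (Σ-+ m (λ i → h (suc i)) (λ i → h′ (suc i))))

    Σ-*ˡ : ∀ m (q : Term V) (h : Fin m → Term V) → q ⊗ Σ[ m ] h ≋ Σ[ m ] (λ i → q ⊗ h i)
    Σ-*ˡ zero    q h = zeroʳ q
    Σ-*ˡ (suc m) q h = ≋-trans (distribˡ q (h zero) _) (⊕-cong ≋-refl (Σ-*ˡ m q (λ i → h (suc i))))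

    module _ {m : ℕ} (f : Fin m → Term V) where

      InIdeal-resp : ∀ {p q} → p ≋ q → InIdeal f q → InIdeal f p
      InIdeal-resp p≋q (h , q≋Σhf) = h , ≋-trans p≋q q≋Σhf

      InIdeal-zero : InIdeal f (con 0#)
      InIdeal-zero = (λ _ → con 0#) , ≋-sym (≋-trans (Σ-cong m (λ i → zeroˡ (f i))) (Σ-zero m))

      InIdeal-+ : ∀ {p q} → InIdeal f p → InIdeal f q → InIdeal f (p ⊕ q)
      InIdeal-+ (h , p≋) (h′ , q≋) = (λ i → h i ⊕ h′ i) ,
        ≋-trans (⊕-cong p≋ q≋)
          (≋-trans (Σ-+ m _ _) (Σ-cong m λ i → ≋-sym (distribʳ (f i) (h i) (h′ i))))

      InIdeal-*ˡ : ∀ q {p} → InIdeal f p → InIdeal f (q ⊗ p)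
      InIdeal-*ˡ q (h , p≋) = (λ i → q ⊗ h i) ,
        ≋-trans (⊗-cong ≋-refl p≋)
          (≋-trans (Σ-*ˡ m q _) (Σ-cong m λ i → ≋-sym (⊗-assoc q (h i) (f i))))

      InIdeal-⊝ : ∀ {p} → InIdeal f p → InIdeal f (⊝ p)
      InIdeal-⊝ {p} p∈I = InIdeal-resp (≋-sym (-1*x≈-x p)) (InIdeal-*ˡ (⊝ con 1#) p∈I)

    InIdeal-generator : ∀ {m} (f : Fin m → Term V) j → InIdeal f (f j)
    InIdeal-generator {suc m} f zero = h , ≋-sym (begin
        con 1# ⊗ f zero ⊕ Σ[ m ] (λ i → con 0# ⊗ f (suc i)) ≈⟨ ⊕-cong (⊗-idˡ _) (Σ-cong m λ _ → zeroˡ _) ⟩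
        f zero ⊕ Σ[ m ] (λ _ → con 0#)                     ≈⟨ ⊕-cong ≋-refl (Σ-zero m) ⟩
        f zero ⊕ con 0#                                    ≈⟨ +-identityʳ (f zero) ⟩
        f zero                                             ∎)
      where
      h : Fin (suc m) → Term V
      h zero    = con 1#
      h (suc _) = con 0#
    InIdeal-generator {suc m} f (suc j) with InIdeal-generator (λ i → f (suc i)) j
    ... | h′ , fⱼ≋Σ = h , ≋-trans fⱼ≋Σ (≋-sym (begin
        con 0# ⊗ f zero ⊕ Σ[ m ] (λ i → h′ i ⊗ f (suc i)) ≈⟨ ⊕-cong (zeroˡ (f zero)) ≋-refl ⟩
        con 0# ⊕ Σ[ m ] (λ i → h′ i ⊗ f (suc i))          ≈⟨ ⊕-idˡ _ ⟩
        Σ[ m ] (λ i → h′ i ⊗ f (suc i))                   ∎))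
      where
      h : Fin (suc m) → Term V
      h zero    = con 0#
      h (suc i) = h′ i

    module CongruenceModulo {m : ℕ} (f : Fin m → Term V) where
      infix 4 _≈ᴵ_
      _≈ᴵ_ : Term V → Term V → Set (c ⊔ ℓ)
      p ≈ᴵ q = InIdeal f (p - q)

      ≈ᴵ-refl : ∀ p → p ≈ᴵ p
      ≈ᴵ-refl p = InIdeal-resp f (x≈y⇒x∙y⁻¹≈ε ≋-refl) (InIdeal-zero f)

      ≈ᴵ-+ : ∀ {p p′ q q′} → p ≈ᴵ p′ → q ≈ᴵ q′ → p ⊕ q ≈ᴵ p′ ⊕ q′
      ≈ᴵ-+ {p} {p′} {q} {q′} p≈ q≈ = InIdeal-resp f (+-sub-+ ring p q p′ q′) (InIdeal-+ f p≈ q≈)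

      ≈ᴵ-* : ∀ {p p′ q q′} → p ≈ᴵ p′ → q ≈ᴵ q′ → p ⊗ q ≈ᴵ p′ ⊗ q′
      ≈ᴵ-* {p} {p′} {q} {q′} p≈ q≈ =
        InIdeal-resp f (≋-trans (*-sub-* ring p q p′ q′) (⊕-cong ≋-refl (⊗-comm _ q′)))
                       (InIdeal-+ f (InIdeal-*ˡ f p q≈) (InIdeal-*ˡ f q′ p≈))

      ≈ᴵ-⊝ : ∀ {p p′} → p ≈ᴵ p′ → ⊝ p ≈ᴵ ⊝ p′
      ≈ᴵ-⊝ {p} {p′} p≈ = InIdeal-resp f (-‿+-comm p (⊝ p′)) (InIdeal-⊝ f p≈)

      subst-≈ᴵ : ∀ {W} {σ τ : W → Term V} → (∀ w → σ w ≈ᴵ τ w) → ∀ p → subst σ p ≈ᴵ subst τ p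
      subst-≈ᴵ σ≈τ (var w) = σ≈τ w
      subst-≈ᴵ σ≈τ (con b) = ≈ᴵ-refl (con b)
      subst-≈ᴵ σ≈τ (p ⊕ q) = ≈ᴵ-+ (subst-≈ᴵ σ≈τ p) (subst-≈ᴵ σ≈τ q)
      subst-≈ᴵ σ≈τ (p ⊗ q) = ≈ᴵ-* (subst-≈ᴵ σ≈τ p) (subst-≈ᴵ σ≈τ q)
      subst-≈ᴵ σ≈τ (⊝ p)   = ≈ᴵ-⊝ (subst-≈ᴵ σ≈τ p)

  module _ {n m k : ℕ} (f : Fin m → Term (Fin n)) (g : Fin k → Term (Fin n)) where
    open CommutativeRing (polynomialRing (Fin n)) using (+-congʳ; +-identityʳ; ring)
    open RingProperties ring using (-0#≈0#)
    open CongruenceModulo f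

    plug-≈ᴵ-plug0 : ∀ v → plug f g v ≈ᴵ plug (λ _ → con 0#) g v
    plug-≈ᴵ-plug0 (inj₁ i)        = ≈ᴵ-refl (var i)
    plug-≈ᴵ-plug0 (inj₂ (inj₁ j)) =
      InIdeal-resp f (≋-trans (⊕-cong ≋-refl -0#≈0#) (+-identityʳ (f j))) (InIdeal-generator f j)
    plug-≈ᴵ-plug0 (inj₂ (inj₂ l)) = ≈ᴵ-refl (g l)

    oneMinusC0g-InIdeal : ∀ C → subst (plug f g) C ≋ con 1# → InIdeal f (oneMinusC0g g C)
    oneMinusC0g-InIdeal C C[f,g]≋1 =
      InIdeal-resp f (+-congʳ (≋-sym C[f,g]≋1)) (subst-≈ᴵ plug-≈ᴵ-plug0 C)

  oneMinusC0g-nonzero : ∀ {n m k} (g : Fin k → Term (Fin n))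
                      → (a : Fin n → Carrier) → CommonZero g a
                      → (C : Term (XYZ n m k))
                      → subst (plug (λ _ → con 0#) (λ _ → con 0#)) C ≋ con 0#
                      → ¬ (oneMinusC0g g C ≋ zeroPoly)
  oneMinusC0g-nonzero g a g[a]≈0 C C[0,0]≋0 1-C[0,g]≋0 =
    0≉1 (𝔽.sym (𝔽.trans 1≈C[a,0,g[a]] C[a,0,g[a]]≈0))
    where
    open RingProperties 𝔽.ring using (x∙y⁻¹≈ε⇒x≈y)
    plug0g≈plug00 : ∀ v → eval a (plug (λ _ → con 0#) g v)
                        ≈ eval a (plug (λ _ → con 0#) (λ _ → con 0#) v)
    plug0g≈plug00 (inj₁ i)        = 𝔽.refl
    plug0g≈plug00 (inj₂ (inj₁ j)) = 𝔽.refl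
    plug0g≈plug00 (inj₂ (inj₂ l)) = g[a]≈0 l
    C[a,0,g[a]]≈0 : eval a (subst (plug (λ _ → con 0#) g) C) ≈ 0#
    C[a,0,g[a]]≈0 = 𝔽.trans (eval-subst-cong a plug0g≈plug00 C) (eval-cong a C[0,0]≋0)
    1≈C[a,0,g[a]] : 1# ≈ eval a (subst (plug (λ _ → con 0#) g) C)
    1≈C[a,0,g[a]] = x∙y⁻¹≈ε⇒x≈y _ _ (eval-cong a 1-C[0,g]≋0)

open Poly

lemma8p1 : {c ℓ : Level} (𝔽 : Field c ℓ) (n m k : ℕ)
           (f : Fin m → Term 𝔽 (Fin n)) (g : Fin k → Term 𝔽 (Fin n))
           → ¬ (∃ λ a → CommonZero 𝔽 f a × CommonZero 𝔽 g a)
           → (∃ λ a → CommonZero 𝔽 g a)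
           → (C : Term 𝔽 (XYZ 𝔽 n m k)) → IsIPSRefutation 𝔽 f g C
           → ¬ (_≋_ 𝔽 (oneMinusC0g 𝔽 g C) (zeroPoly 𝔽))
             × InIdeal 𝔽 f (oneMinusC0g 𝔽 g C)
lemma8p1 𝔽 n m k f g _ (a , g[a]≈0) C (C[0,0]≋0 , C[f,g]≋1) =
  oneMinusC0g-nonzero 𝔽 g a g[a]≈0 C C[0,0]≋0 , oneMinusC0g-InIdeal 𝔽 f g C C[f,g]≋1
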